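{- Let $k\in\mathbb{N}$, $\tau\in\mathcal{T}_k$, and let $\sigma$ be a subterm of $\tau$. Then $G(\sigma)$ is isomorphic to a subgraph of $G(\tau)$, i.e. $G(\sigma)$ embeds into $G(\tau)$.
   Context: A graph is a triple $(V,E,\rho)$ with $V,E$ finite subsets of $\mathbb{N}$ and $\rho\subseteq E\times V$ such that each edge is incident to exactly two distinct vertices (parallel edges allowed). An embedding of $H$ into $G$ is a pair of injective maps $\phi:V(H)\to V(G)$, $\nu:E(H)\to E(G)$ with $(e,v)\in\rho_H\iff(\nu(e),\phi(v))\in\rho_G$. For $i\in\{0,1\}$, $G^{(i)}$ renames vertices $v\mapsto 2v+i$ and edges $e\mapsto 2e+i$; $G\uplus H=G^{(0)}\cup H^{(1)}$. Instructive decompositions: the $k$-instructive alphabet has $\mathtt{Leaf}$ (arity 0), $\mathtt{IntroVertex}_u,\mathtt{ForgetVertex}_u$ ($u\in[k+1]$), $\mathtt{IntroEdge}_{u,v}$ (distinct $u,v$) of arity 1, $\mathtt{Join}$ of arity 2; $\mathcal{T}_k$ is the set of terms legal w.r.t. bags ($\mathtt{Leaf}$: $\emptyset$; IntroVertex$_u$ needs $u\notin$ bag and adds it; ForgetVertex$_u$ needs $u\in$ bag and removes it; IntroEdge$_{u,v}$ needs $u,v\in$ bag; Join needs equal child bags). Each $\tau$ defines $G(\tau)$, $B(\tau)$ and an injective map $\theta_\tau:B(\tau)\to V(G(\tau))$: Leaf: empty graph; $\mathtt{IntroVertex}_u(\sigma)$: add the vertex $x=\min(\mathbb{N}_+\setminus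 V(G(\sigma)))$ as an isolated vertex, $\theta(u)=x$; $\mathtt{ForgetVertex}_u(\sigma)$: same graph, $\theta$ restricted to the new bag; $\mathtt{IntroEdge}_{u,v}(\sigma)$: add edge $e=\min(\mathbb{N}_+\setminus E(G(\sigma)))$ with endpoints $\theta_\sigma(u),\theta_\sigma(v)$; $\mathtt{Join}(\sigma_1,\sigma_2)$ with common bag $b$: $H=G(\sigma_1)\uplus G(\sigma_2)$, $\mu(2\theta_{\sigma_2}(u)+1)=2\theta_{\sigma_1}(u)$ for $u\in b$ and $\mu$ the identity elsewhere; $G(\tau)$ has vertices $\mu(V(H))$, edges $E(H)$, incidence $\{(e,\mu(v)):(e,v)\in\rho_H\}$, and $\theta_\tau(u)=2\theta_{\sigma_1}(u)$. -}

module Defs where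

open import Data.Nat using (ℕ; zero; suc; _*_; _+_)
open import Data.Nat.Properties using (_≟_)
open import Data.Bool using (Bool; true; false; if_then_else_)
open import Data.Fin using (Fin)
import Data.Fin.Properties as FinP
open import Data.Fin.Subset using (Subset; inside; outside; _∈_; _∉_) renaming (⊥ to ∅)
open import Data.Vec using (Vec; _[_]≔_; lookup)
open import Data.List using (List; []; _∷_; _++_; map; length; filter)
open import Data.List.Membership.DecPropositional _≟_ using (_∈?_)
import Data.List.Membership.Propositional as LM
open import Data.List.Relation.Unary.Any using (Any)
open import Data.Sum using (_⊎_)
open import Data.Product using (_×_; _,_; proj₁; proj₂)
open import Relation.Nullary using (yes; no; does)
open import Relation.Binary.PropositionalEquality using (_≡_)
open import Function.Bundles using (_⇔_)
open import Data.Fin using () renaming (_≟_ to _≟F_)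
open import Data.List using (allFin) renaming (filterᵇ to filterᵇ)

-- Graphs: V, E finite subsets of ℕ (given as lists; only membership
-- matters), ρ ⊆ E × V given as a list of (edge , vertex) pairs.

record Graph : Set where
  constructor mkGraph
  field
    V : List ℕ
    E : List ℕ
    ρ : List (ℕ × ℕ)
open Graph public

record IsGraph (G : Graph) : Set where
  field
    ρ⊆E×V : ∀ e v → (e , v) LM.∈ ρ G → (e LM.∈ E G) × (v LM.∈ V G)
    two   : ∀ e → e LM.∈ E G →
            Data.Product.Σ ℕ λ u → Data.Product.Σ ℕ λ w →
              (Relation.Nullary.¬ (u ≡ w)) × ((e , u) LM.∈ ρ G) × ((e , w) LM.∈ ρ G)
              × (∀ x → (e , x) LM.∈ ρ G → (x ≡ u) ⊎ (x ≡ w))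

-- Embedding of H into G: injective φ : V(H) → V(G), ν : E(H) → E(G)
-- (maps ℕ → ℕ; only their values on V(H), E(H) matter) preserving and
-- reflecting incidence.
record Embedding (H G : Graph) : Set where
  field
    φ : ℕ → ℕ
    ν : ℕ → ℕ
    φ-into : ∀ v → v LM.∈ V H → φ v LM.∈ V G
    ν-into : ∀ e → e LM.∈ E H → ν e LM.∈ E G
    φ-inj  : ∀ v w → v LM.∈ V H → w LM.∈ V H → φ v ≡ φ w → v ≡ w
    ν-inj  : ∀ e f → e LM.∈ E H → f LM.∈ E H → ν e ≡ ν f → e ≡ f
    incidence : ∀ e v → e LM.∈ E H → v LM.∈ V H →
                ((e , v) LM.∈ ρ H) ⇔ ((ν e , φ v) LM.∈ ρ G)

-- min (ℕ₊ ∖ xs): search candidates 1, 2, …, length xs + 1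

firstFree : ℕ → ℕ → List ℕ → ℕ
firstFree zero    c xs = c
firstFree (suc f) c xs = if does (c ∈? xs) then firstFree f (suc c) xs else c

fresh : List ℕ → ℕ
fresh xs = firstFree (length xs) 1 xs

-- Legal k-instructive terms, indexed by their bag (a subset of [k+1],
-- the labels 1..k+1 being represented by Fin (suc k)).

data Term (k : ℕ) : Subset (suc k) → Set where
  Leaf        : Term k ∅
  IntroVertex : ∀ {b} (u : Fin (suc k)) → u ∉ b → Term k b → Term k (b [ u ]≔ inside)
  ForgetVertex : ∀ {b} (u : Fin (suc k)) → u ∈ b → Term k b → Term k (b [ u ]≔ outside)
  IntroEdge   : ∀ {b} (u v : Fin (suc k)) → Relation.Nullary.¬ (u ≡ v) →
                u ∈ b → v ∈ b → Term k b → Term k b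
  Join        : ∀ {b} → Term k b → Term k b → Term k b

data Subterm {k : ℕ} {b' : Subset (suc k)} (σ : Term k b') :
             ∀ {b} → Term k b → Set where
  here  : Subterm σ σ
  inIV  : ∀ {b} {u} {p} {τ : Term k b} → Subterm σ τ → Subterm σ (IntroVertex u p τ)
  inFV  : ∀ {b} {u} {p} {τ : Term k b} → Subterm σ τ → Subterm σ (ForgetVertex u p τ)
  inIE  : ∀ {b} {u v} {p q r} {τ : Term k b} → Subterm σ τ → Subterm σ (IntroEdge u v p q r τ)
  inJ₁  : ∀ {b} {τ₁ τ₂ : Term k b} → Subterm σ τ₁ → Subterm σ (Join τ₁ τ₂)
  inJ₂  : ∀ {b} {τ₁ τ₂ : Term k b} → Subterm σ τ₂ → Subterm σ (Join τ₁ τ₂)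

-- Semantics: the graph G(τ) together with θ_τ (meaningful on B(τ) only)

-- G ⊎ H = G⁽⁰⁾ ∪ H⁽¹⁾
ren : ℕ → ℕ → ℕ
ren i x = 2 * x + i

renG : ℕ → Graph → Graph
renG i G = mkGraph (map (ren i) (V G)) (map (ren i) (E G))
                   (map (λ p → ren i (proj₁ p) , ren i (proj₂ p)) (ρ G))

_⊎G_ : Graph → Graph → Graph
G ⊎G H = mkGraph (V (renG 0 G) ++ V (renG 1 H)) (E (renG 0 G) ++ E (renG 1 H))
                 (ρ (renG 0 G) ++ ρ (renG 1 H))

applyMap : List (ℕ × ℕ) → ℕ → ℕ
applyMap []             x = x
applyMap ((a , c) ∷ ps) x = if does (x ≟ a) then c else applyMap ps x

members : ∀ {n} → Subset n → List (Fin n)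
members b = filterᵇ (lookup b) (allFin _)

update : ∀ {k} → (Fin (suc k) → ℕ) → Fin (suc k) → ℕ → Fin (suc k) → ℕ
update θ u x w = if does (w ≟F u) then x else θ w

⟦_⟧ : ∀ {k b} → Term k b → Graph × (Fin (suc k) → ℕ)
⟦ Leaf ⟧ = mkGraph [] [] [] , λ _ → 0
⟦ IntroVertex u _ σ ⟧ with ⟦ σ ⟧
... | G , θ = let x = fresh (V G) in
              mkGraph (V G ++ x ∷ []) (E G) (ρ G) , update θ u x
⟦ ForgetVertex u _ σ ⟧ = ⟦ σ ⟧
⟦ IntroEdge u v _ _ _ σ ⟧ with ⟦ σ ⟧
... | G , θ = let e = fresh (E G) in
              mkGraph (V G) (E G ++ e ∷ []) (ρ G ++ (e , θ u) ∷ (e , θ v) ∷ []) , θ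
⟦ Join {b} σ₁ σ₂ ⟧ with ⟦ σ₁ ⟧ | ⟦ σ₂ ⟧
... | G₁ , θ₁ | G₂ , θ₂ =
  let H = G₁ ⊎G G₂
      μ = applyMap (map (λ u → ren 1 (θ₂ u) , ren 0 (θ₁ u)) (members b))
  in mkGraph (map μ (V H)) (E H) (map (λ p → proj₁ p , μ (proj₂ p)) (ρ H))
     , λ u → ren 0 (θ₁ u)

G⟦_⟧ : ∀ {k b} → Term k b → Graph
G⟦ τ ⟧ = proj₁ ⟦ τ ⟧

{-# OPTIONS --safe #-}
-- Every construction step only enlarges the graph.  IntroVertex and IntroEdge add a
-- vertex or edge with a fresh name, and Join embeds each side G_i by v ↦ μ (2v + i), where
-- the gluing map μ sends the copy of θ₂ u to the copy of θ₁ u for each bag label u.  The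
-- second map stays injective because θ₁ is injective on the bag, an invariant maintained
-- along every term.  Composing these one-step embeddings along the path from τ down to σ
-- embeds G(σ) in G(τ).
module Submission where

open import Defs
open import Data.Nat using (ℕ; suc)
open import Data.Fin.Subset using (Subset)

open import Data.Nat using (zero; _+_; _*_; _≤_; _<_; z≤n; s≤s; _≡ᵇ_)
open import Data.Nat.Properties
  using (_≟_; ≡ᵇ⇒≡; +-identityʳ; +-suc; +-comm; +-cancelʳ-≡; *-cancelˡ-≡; even≢odd; n<1+n; <-irrefl; suc-injective)
open import Data.Bool using (true; false; T; T?)
open import Data.Bool.Properties using (T-≡)
open import Data.Fin using (Fin; toℕ) renaming (_≟_ to _≟ᶠ_)
open import Data.Fin.Properties using (pigeonhole; toℕ≤pred[n])
open import Data.Fin.Subset using (inside; outside)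
  renaming (_∈_ to _∈ₛ_; _⊆_ to _⊆ₛ_)
open import Data.Fin.Subset.Properties using (∉⊥)
open import Data.Vec using (lookup; _[_]≔_)
open import Data.Vec.Properties using (lookup⇒[]=; []=⇒lookup; lookup∘update′; []≔-updates; []=-injective)
open import Data.List using (List; []; _∷_; _++_; map; length; allFin)
open import Data.List.Membership.Propositional using (_∈_; _∉_)
open import Data.List.Membership.Propositional.Properties using (∈-map⁺; ∈-map⁻; ∈-++⁺ˡ; ∈-++⁺ʳ; ∈-++⁻; ∈-filter⁻)
open import Data.List.Membership.Setoid.Properties using (index-injective)
open import Data.List.Membership.DecPropositional _≟_ using (_∈?_)
open import Data.List.Relation.Binary.Subset.Propositional using (_⊆_)
open import Data.List.Relation.Binary.Subset.Propositional.Properties using (xs⊆xs++ys; xs⊆ys++xs)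
open import Data.List.Relation.Unary.Any using (here; there; index)
open import Data.Sum using (_⊎_; inj₁; inj₂)
open import Data.Product using (∃₂; ∃-syntax; _×_; _,_; proj₁; proj₂)
open import Function using (_∘_)
open import Function.Bundles using (mk⇔; Equivalence)
open import Relation.Nullary using (¬_; yes; no; contradiction)
open import Relation.Binary.PropositionalEquality
  using (_≡_; _≢_; refl; sym; trans; cong; subst; setoid; module ≡-Reasoning)

embedding-trans : ∀ {A B C} → Embedding A B → Embedding B C → Embedding A C
embedding-trans f g = record
  { φ = G.φ ∘ F.φ
  ; ν = G.ν ∘ F.ν
  ; φ-into = λ v v∈ → G.φ-into _ (F.φ-into v v∈)
  ; ν-into = λ e e∈ → G.ν-into _ (F.ν-into e e∈)
  ; φ-inj = λ v w v∈ w∈ eq →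
      F.φ-inj v w v∈ w∈ (G.φ-inj _ _ (F.φ-into v v∈) (F.φ-into w w∈) eq)
  ; ν-inj = λ e e' e∈ e'∈ eq →
      F.ν-inj e e' e∈ e'∈ (G.ν-inj _ _ (F.ν-into e e∈) (F.ν-into e' e'∈) eq)
  ; incidence = λ e v e∈ v∈ →
      let f⇔ = F.incidence e v e∈ v∈
          g⇔ = G.incidence _ _ (F.ν-into e e∈) (F.φ-into v v∈)
      in mk⇔ (Equivalence.to g⇔ ∘ Equivalence.to f⇔) (Equivalence.from f⇔ ∘ Equivalence.from g⇔)
  }
  where
  module F = Embedding f
  module G = Embedding g

⊆-embedding : ∀ {G H} → V G ⊆ V H → E G ⊆ E H → ρ G ⊆ ρ H →
              (∀ {e v} → e ∈ E G → (e , v) ∈ ρ H → (e , v) ∈ ρ G) → Embedding G H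
⊆-embedding V⊆ E⊆ ρ⊆ ρ-restricts = record
  { φ = λ v → v ; ν = λ e → e
  ; φ-into = λ _ → V⊆ ; ν-into = λ _ → E⊆
  ; φ-inj = λ _ _ _ _ eq → eq ; ν-inj = λ _ _ _ _ eq → eq
  ; incidence = λ _ _ e∈ _ → mk⇔ ρ⊆ (ρ-restricts e∈)
  }

embedding-refl : ∀ {G} → Embedding G G
embedding-refl = ⊆-embedding (λ v∈ → v∈) (λ e∈ → e∈) (λ i∈ → i∈) (λ _ i∈ → i∈)

addVertices-embedding : ∀ G vs → Embedding G (mkGraph (V G ++ vs) (E G) (ρ G))
addVertices-embedding G vs = ⊆-embedding (xs⊆xs++ys (V G) vs) (λ e∈ → e∈) (λ i∈ → i∈) (λ _ i∈ → i∈)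

addEdge-embedding : ∀ G {e} x y → e ∉ E G →
                    Embedding G (mkGraph (V G) (E G ++ e ∷ []) (ρ G ++ (e , x) ∷ (e , y) ∷ []))
addEdge-embedding G {e} x y e∉ =
  ⊆-embedding (λ v∈ → v∈) (xs⊆xs++ys (E G) _) (xs⊆xs++ys (ρ G) _) old-incidence
  where
  old-incidence : ∀ {e' v} → e' ∈ E G → (e' , v) ∈ ρ G ++ (e , x) ∷ (e , y) ∷ [] → (e' , v) ∈ ρ G
  old-incidence e'∈ i∈ with ∈-++⁻ (ρ G) i∈
  ... | inj₁ i∈ρ                 = i∈ρ
  ... | inj₂ (here refl)         = contradiction e'∈ e∉
  ... | inj₂ (there (here refl)) = contradiction e'∈ e∉

firstFree-∈ : ∀ f c xs → firstFree f c xs ∈ xs → ∀ {i} → i ≤ f → c + i ∈ xs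
firstFree-∈ zero    c xs ff∈ z≤n = subst (_∈ xs) (sym (+-identityʳ c)) ff∈
firstFree-∈ (suc f) c xs ff∈ i≤ with c ∈? xs
firstFree-∈ (suc f) c xs ff∈ z≤n           | yes c∈ = subst (_∈ xs) (sym (+-identityʳ c)) c∈
firstFree-∈ (suc f) c xs ff∈ (s≤s {i} i≤f) | yes _ =
  subst (_∈ xs) (sym (+-suc c i)) (firstFree-∈ f (suc c) xs ff∈ i≤f)
firstFree-∈ (suc f) c xs ff∈ i≤            | no c∉ = contradiction ff∈ c∉

-- Otherwise 1, …, length xs + 1 would be distinct members of xs.
fresh∉ : ∀ xs → fresh xs ∉ xs
fresh∉ xs fresh∈xs = collision-impossible (pigeonhole (n<1+n n) position)
  where
  n = length xs
  member : (i : Fin (suc n)) → suc (toℕ i) ∈ xs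
  member i = firstFree-∈ n 1 xs fresh∈xs (toℕ≤pred[n] i)
  position : Fin (suc n) → Fin n
  position i = index (member i)
  collision-impossible : ¬ ∃₂ λ i j → toℕ i < toℕ j × position i ≡ position j
  collision-impossible (i , j , i<j , same) =
    <-irrefl (suc-injective (index-injective (setoid ℕ) (member i) (member j) same)) i<j

ren-injective : ∀ i {a c} → ren i a ≡ ren i c → a ≡ c
ren-injective i {a} {c} eq = *-cancelˡ-≡ a c 2 (+-cancelʳ-≡ i (2 * a) (2 * c) eq)

ren0≢ren1 : ∀ a c → ren 0 a ≢ ren 1 c
ren0≢ren1 a c eq = even≢odd a c (begin
  2 * a       ≡⟨ sym (+-identityʳ (2 * a)) ⟩
  ren 0 a     ≡⟨ eq ⟩
  ren 1 c     ≡⟨ +-comm (2 * c) 1 ⟩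
  suc (2 * c) ∎)
  where open ≡-Reasoning

∈-ρ-renG⁻ : ∀ i G {e y} → (ren i e , y) ∈ ρ (renG i G) → ∃[ v ] (e , v) ∈ ρ G × y ≡ ren i v
∈-ρ-renG⁻ i G {e} i∈ with ∈-map⁻ _ i∈
... | (e' , v) , i∈ρ , eq with ren-injective i {e} {e'} (cong proj₁ eq)
...   | refl = v , i∈ρ , cong proj₂ eq

ren0∉ρ-renG1 : ∀ G {e y} → (ren 0 e , y) ∉ ρ (renG 1 G)
ren0∉ρ-renG1 G {e} i∈ with ∈-map⁻ _ i∈
... | (e' , _) , _ , eq = ren0≢ren1 e e' (cong proj₁ eq)

ren1∉ρ-renG0 : ∀ G {e y} → (ren 1 e , y) ∉ ρ (renG 0 G)
ren1∉ρ-renG0 G {e} i∈ with ∈-map⁻ _ i∈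
... | (e' , _) , _ , eq = ren0≢ren1 e' e (sym (cong proj₁ eq))

∈-ρ-⊎G⁻ˡ : ∀ G₁ G₂ {e y} → (ren 0 e , y) ∈ ρ (G₁ ⊎G G₂) → ∃[ v ] (e , v) ∈ ρ G₁ × y ≡ ren 0 v
∈-ρ-⊎G⁻ˡ G₁ G₂ {e} i∈ with ∈-++⁻ (ρ (renG 0 G₁)) i∈
... | inj₁ i∈₁ = ∈-ρ-renG⁻ 0 G₁ i∈₁
... | inj₂ i∈₂ = contradiction i∈₂ (ren0∉ρ-renG1 G₂ {e})

∈-ρ-⊎G⁻ʳ : ∀ G₁ G₂ {e y} → (ren 1 e , y) ∈ ρ (G₁ ⊎G G₂) → ∃[ v ] (e , v) ∈ ρ G₂ × y ≡ ren 1 v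
∈-ρ-⊎G⁻ʳ G₁ G₂ {e} i∈ with ∈-++⁻ (ρ (renG 0 G₁)) i∈
... | inj₁ i∈₁ = contradiction i∈₁ (ren1∉ρ-renG0 G₁ {e})
... | inj₂ i∈₂ = ∈-ρ-renG⁻ 1 G₂ i∈₂

-- does (x ≟ a) computes to x ≡ᵇ a, so that is what the case split must abstract over.
applyMap-cases : ∀ ps x → applyMap ps x ≡ x ⊎ ∃[ p ] p ∈ ps × x ≡ proj₁ p × applyMap ps x ≡ proj₂ p
applyMap-cases []             x = inj₁ refl
applyMap-cases ((a , c) ∷ ps) x with x ≡ᵇ a in x≡ᵇa
... | true  = inj₂ ((a , c) , here refl , ≡ᵇ⇒≡ x a (subst T (sym x≡ᵇa) _) , refl)
... | false with applyMap-cases ps x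
...   | inj₁ fixed                 = inj₁ fixed
...   | inj₂ (p , p∈ , x≡ , maps) = inj₂ (p , there p∈ , x≡ , maps)

∈ₛ-[]≔⁻ : ∀ {n} {b : Subset n} {u w y} → w ≢ u → w ∈ₛ b [ u ]≔ y → w ∈ₛ b
∈ₛ-[]≔⁻ {b = b} {y = y} w≢u w∈ = lookup⇒[]= _ b (trans (sym (lookup∘update′ w≢u b y)) ([]=⇒lookup w∈))

[]≔outside-⊆ : ∀ {n} (b : Subset n) u → b [ u ]≔ outside ⊆ₛ b
[]≔outside-⊆ b u {w} w∈ with w ≟ᶠ u
... | no w≢u = ∈ₛ-[]≔⁻ w≢u w∈
... | yes refl with []=-injective w∈ ([]≔-updates b u)
...   | ()

members⁻ : ∀ {n} (b : Subset n) {u} → u ∈ members b → u ∈ₛ b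
members⁻ b {u} u∈ =
  lookup⇒[]= u b (Equivalence.to T-≡ (proj₂ (∈-filter⁻ (T? ∘ lookup b) {xs = allFin _} u∈)))

record WellLabelled {n} (vs : List ℕ) (θ : Fin n → ℕ) (b : Subset n) : Set where
  field
    labels-∈         : ∀ {u} → u ∈ₛ b → θ u ∈ vs
    labels-injective : ∀ {u w} → u ∈ₛ b → w ∈ₛ b → θ u ≡ θ w → u ≡ w
open WellLabelled

wellLabelled-⊆ : ∀ {n vs θ} {b b' : Subset n} → b' ⊆ₛ b → WellLabelled vs θ b → WellLabelled vs θ b'
wellLabelled-⊆ b'⊆b wl = record
  { labels-∈         = labels-∈ wl ∘ b'⊆b
  ; labels-injective = λ u∈ w∈ → labels-injective wl (b'⊆b u∈) (b'⊆b w∈)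
  }

wellLabelled-addVertex : ∀ {k vs θ} {b : Subset (suc k)} u {x} → WellLabelled vs θ b → x ∉ vs →
  WellLabelled (vs ++ x ∷ []) (update θ u x) (b [ u ]≔ inside)
wellLabelled-addVertex {vs = vs} {θ} {b} u {x} wl x∉ = record
  { labels-∈ = labels-∈′ ; labels-injective = labels-injective′ }
  where
  labels-∈′ : ∀ {w} → w ∈ₛ b [ u ]≔ inside → update θ u x w ∈ vs ++ x ∷ []
  labels-∈′ {w} w∈ with w ≟ᶠ u
  ... | yes refl = ∈-++⁺ʳ vs (here refl)
  ... | no w≢u   = ∈-++⁺ˡ (labels-∈ wl (∈ₛ-[]≔⁻ w≢u w∈))
  old-label≢x : ∀ {w} → w ≢ u → w ∈ₛ b [ u ]≔ inside → θ w ≢ x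
  old-label≢x w≢u w∈ refl = x∉ (labels-∈ wl (∈ₛ-[]≔⁻ w≢u w∈))
  labels-injective′ : ∀ {w w'} → w ∈ₛ b [ u ]≔ inside → w' ∈ₛ b [ u ]≔ inside →
                      update θ u x w ≡ update θ u x w' → w ≡ w'
  labels-injective′ {w} {w'} w∈ w'∈ eq with w ≟ᶠ u | w' ≟ᶠ u
  ... | yes refl | yes refl = refl
  ... | yes refl | no w'≢u  = contradiction (sym eq) (old-label≢x w'≢u w'∈)
  ... | no w≢u   | yes refl = contradiction eq (old-label≢x w≢u w∈)
  ... | no w≢u   | no w'≢u  = labels-injective wl (∈ₛ-[]≔⁻ w≢u w∈) (∈ₛ-[]≔⁻ w'≢u w'∈) eq

module Gluing {k} (b : Subset (suc k)) (G₁ G₂ : Graph) (θ₁ θ₂ : Fin (suc k) → ℕ)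
            (wl₁ : WellLabelled (V G₁) θ₁ b) where

  μ : ℕ → ℕ
  μ = applyMap (map (λ u → ren 1 (θ₂ u) , ren 0 (θ₁ u)) (members b))

  H : Graph
  H = G₁ ⊎G G₂

  joined : Graph
  joined = mkGraph (map μ (V H)) (E H) (map (λ p → proj₁ p , μ (proj₂ p)) (ρ H))

  μ-cases : ∀ x → μ x ≡ x ⊎ ∃[ u ] u ∈ₛ b × x ≡ ren 1 (θ₂ u) × μ x ≡ ren 0 (θ₁ u)
  μ-cases x with applyMap-cases (map (λ u → ren 1 (θ₂ u) , ren 0 (θ₁ u)) (members b)) x
  ... | inj₁ fixed = inj₁ fixed
  ... | inj₂ (p , p∈ , x≡ , glued) with ∈-map⁻ _ p∈
  ...   | u , u∈ , refl = inj₂ (u , members⁻ b u∈ , x≡ , glued)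

  μ-ren0 : ∀ v → μ (ren 0 v) ≡ ren 0 v
  μ-ren0 v with μ-cases (ren 0 v)
  ... | inj₁ fixed             = fixed
  ... | inj₂ (u , _ , v≡ , _) = contradiction v≡ (ren0≢ren1 v (θ₂ u))

  μ∘ren0-injective : ∀ {v w} → μ (ren 0 v) ≡ μ (ren 0 w) → v ≡ w
  μ∘ren0-injective {v} {w} eq = ren-injective 0 (trans (sym (μ-ren0 v)) (trans eq (μ-ren0 w)))

  -- Glued odd vertices land on distinct even ones because θ₁ is injective on the bag.
  μ∘ren1-injective : ∀ {v w} → μ (ren 1 v) ≡ μ (ren 1 w) → v ≡ w
  μ∘ren1-injective {v} {w} eq with μ-cases (ren 1 v) | μ-cases (ren 1 w)
  ... | inj₁ fixedv | inj₁ fixedw = ren-injective 1 (trans (sym fixedv) (trans eq fixedw))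
  ... | inj₁ fixedv | inj₂ (u , _ , _ , gluedw) =
    contradiction (trans (sym gluedw) (trans (sym eq) fixedv)) (ren0≢ren1 (θ₁ u) v)
  ... | inj₂ (u , _ , _ , gluedv) | inj₁ fixedw =
    contradiction (trans (sym gluedv) (trans eq fixedw)) (ren0≢ren1 (θ₁ u) w)
  ... | inj₂ (u , u∈ , v≡ , gluedv) | inj₂ (u' , u'∈ , w≡ , gluedw)
    with labels-injective wl₁ u∈ u'∈ (ren-injective 0 (trans (sym gluedv) (trans eq gluedw)))
  ...   | refl = ren-injective 1 (trans v≡ (sym w≡))

  ∈-ρ-joined⁻ : ∀ {e y} → (e , y) ∈ ρ joined → ∃[ z ] (e , z) ∈ ρ H × y ≡ μ z
  ∈-ρ-joined⁻ i∈ with ∈-map⁻ _ i∈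
  ... | (_ , z) , i∈H , refl = z , i∈H , refl

  side-embedding : ∀ i G →
    V (renG i G) ⊆ V H → E (renG i G) ⊆ E H → ρ (renG i G) ⊆ ρ H →
    (∀ {e y} → (ren i e , y) ∈ ρ H → ∃[ v ] (e , v) ∈ ρ G × y ≡ ren i v) →
    (∀ {v w} → μ (ren i v) ≡ μ (ren i w) → v ≡ w) →
    Embedding G joined
  side-embedding i G V⊆ E⊆ ρ⊆ ∈-ρ-H⁻ μ∘ren-injective = record
    { φ = μ ∘ ren i
    ; ν = ren i
    ; φ-into = λ v v∈ → ∈-map⁺ μ (V⊆ (∈-map⁺ (ren i) v∈))
    ; ν-into = λ e e∈ → E⊆ (∈-map⁺ (ren i) e∈)
    ; φ-inj = λ _ _ _ _ → μ∘ren-injective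
    ; ν-inj = λ _ _ _ _ → ren-injective i
    ; incidence = λ e v _ _ → mk⇔ (∈-map⁺ _ ∘ ρ⊆ ∘ ∈-map⁺ _) (reflects e v)
    }
    where
    reflects : ∀ e v → (ren i e , μ (ren i v)) ∈ ρ joined → (e , v) ∈ ρ G
    reflects e v i∈ with ∈-ρ-joined⁻ i∈
    ... | z , i∈H , μv≡μz with ∈-ρ-H⁻ {e} i∈H
    ...   | v' , i∈G , refl with μ∘ren-injective {v} {v'} μv≡μz
    ...     | refl = i∈G

  embeddingˡ : Embedding G₁ joined
  embeddingˡ = side-embedding 0 G₁ (xs⊆xs++ys _ _) (xs⊆xs++ys _ _) (xs⊆xs++ys _ _)
                              (∈-ρ-⊎G⁻ˡ G₁ G₂) μ∘ren0-injective

  embeddingʳ : Embedding G₂ joined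
  embeddingʳ = side-embedding 1 G₂ (xs⊆ys++xs _ _) (xs⊆ys++xs _ _) (xs⊆ys++xs _ _)
                              (∈-ρ-⊎G⁻ʳ G₁ G₂) μ∘ren1-injective

  joined-wellLabelled : WellLabelled (V joined) (ren 0 ∘ θ₁) b
  joined-wellLabelled = record
    { labels-∈         = λ {u} u∈ → subst (_∈ V joined) (μ-ren0 (θ₁ u))
                                       (Embedding.φ-into embeddingˡ _ (labels-∈ wl₁ u∈))
    ; labels-injective = λ u∈ w∈ → labels-injective wl₁ u∈ w∈ ∘ ren-injective 0
    }

θ⟦_⟧ : ∀ {k b} → Term k b → Fin (suc k) → ℕ
θ⟦ τ ⟧ = proj₂ ⟦ τ ⟧

⟦⟧-wellLabelled : ∀ {k b} (τ : Term k b) → WellLabelled (V G⟦ τ ⟧) θ⟦ τ ⟧ b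
⟦⟧-wellLabelled Leaf = record
  { labels-∈ = λ u∈ → contradiction u∈ ∉⊥ ; labels-injective = λ u∈ → contradiction u∈ ∉⊥ }
⟦⟧-wellLabelled (IntroVertex u _ σ) =
  wellLabelled-addVertex u (⟦⟧-wellLabelled σ) (fresh∉ (V G⟦ σ ⟧))
⟦⟧-wellLabelled (ForgetVertex {b} u _ σ) = wellLabelled-⊆ ([]≔outside-⊆ b u) (⟦⟧-wellLabelled σ)
⟦⟧-wellLabelled (IntroEdge _ _ _ _ _ σ) = ⟦⟧-wellLabelled σ
⟦⟧-wellLabelled (Join {b} σ₁ σ₂) =
  Gluing.joined-wellLabelled b G⟦ σ₁ ⟧ G⟦ σ₂ ⟧ θ⟦ σ₁ ⟧ θ⟦ σ₂ ⟧ (⟦⟧-wellLabelled σ₁)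

join-embeddingˡ : ∀ {k b} (τ₁ τ₂ : Term k b) → Embedding G⟦ τ₁ ⟧ G⟦ Join τ₁ τ₂ ⟧
join-embeddingˡ {b = b} τ₁ τ₂ = Gluing.embeddingˡ b G⟦ τ₁ ⟧ G⟦ τ₂ ⟧ θ⟦ τ₁ ⟧ θ⟦ τ₂ ⟧ (⟦⟧-wellLabelled τ₁)

join-embeddingʳ : ∀ {k b} (τ₁ τ₂ : Term k b) → Embedding G⟦ τ₂ ⟧ G⟦ Join τ₁ τ₂ ⟧
join-embeddingʳ {b = b} τ₁ τ₂ = Gluing.embeddingʳ b G⟦ τ₁ ⟧ G⟦ τ₂ ⟧ θ⟦ τ₁ ⟧ θ⟦ τ₂ ⟧ (⟦⟧-wellLabelled τ₁)

lemma19 : (k : ℕ) {b b' : Subset (suc k)} (τ : Term k b) (σ : Term k b') →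
          Subterm σ τ → Embedding G⟦ σ ⟧ G⟦ τ ⟧
lemma19 k τ σ here = embedding-refl
lemma19 k (IntroVertex _ _ τ) σ (inIV s) =
  embedding-trans (lemma19 k τ σ s) (addVertices-embedding G⟦ τ ⟧ _)
lemma19 k (ForgetVertex _ _ τ) σ (inFV s) = lemma19 k τ σ s
lemma19 k (IntroEdge _ _ _ _ _ τ) σ (inIE s) =
  embedding-trans (lemma19 k τ σ s) (addEdge-embedding G⟦ τ ⟧ _ _ (fresh∉ (E G⟦ τ ⟧)))
lemma19 k (Join τ₁ τ₂) σ (inJ₁ s) = embedding-trans (lemma19 k τ₁ σ s) (join-embeddingˡ τ₁ τ₂)
lemma19 k (Join τ₁ τ₂) σ (inJ₂ s) = embedding-trans (lemma19 k τ₂ σ s) (join-embeddingʳ τ₁ τ₂)
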